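{- Let $\Gamma$ be a binary group and $\Omega\subseteq\Gamma$, and suppose the Cayley graph $\mathrm{Cay}(\Gamma,\Omega)$ has odd-girth $2k+1$. Then the projective cube $\mathcal{PC}_{2k}$ is a subgraph of $\mathrm{Cay}(\Gamma,\Omega)$.
   Context: A binary group is a group $\Gamma$ (written additively) in which $x+x=0$ for every $x\in\Gamma$. For $\Omega\subseteq\Gamma$, the Cayley graph $\mathrm{Cay}(\Gamma,\Omega)$ has vertex set $\Gamma$, with $u$ and $v$ adjacent if and only if $u-v\in\Omega$. The odd-girth of a graph is the length of its shortest odd cycle. The projective cube of dimension $d$, $\mathcal{PC}_d$, is the Cayley graph $\mathrm{Cay}(\mathbb{Z}_2^d,\{e_1,\dots,e_d,J\})$, where $e_1,\dots,e_d$ is the canonical basis of $\mathbb{Z}_2^d$ and $J$ is the all-ones vector. -}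

module Defs where

open import Level using (Level; _⊔_)
open import Data.Nat using (ℕ; zero; suc; _≤_; _*_)
open import Data.Fin using (Fin; zero; suc; inject₁; fromℕ)
open import Data.Bool using (Bool; true; false; _xor_)
open import Data.Vec using (Vec; zipWith; replicate; updateAt)
open import Data.Product using (Σ; ∃; _×_; _,_)
open import Data.Sum using (_⊎_)
open import Relation.Binary.PropositionalEquality using (_≡_)
open import Relation.Unary using (Pred)
open import Function.Definitions using (Injective)
open import Algebra.Structures using (IsAbelianGroup)

Graph : ∀ {v} → Set v → (e : Level) → Set _
Graph V e = V → V → Set e

record BinaryGroup (ℓ : Level) : Set (Level.suc ℓ) where
  field
    Carrier : Set ℓ
    _+_ : Carrier → Carrier → Carrier
    0# : Carrier
    -_ : Carrier → Carrier
    isAbelianGroup : IsAbelianGroup _≡_ _+_ 0# -_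
    binary : ∀ x → x + x ≡ 0#

Cay : ∀ {ℓ ℓ'} (Γ : BinaryGroup ℓ) → Pred (BinaryGroup.Carrier Γ) ℓ' →
      Graph (BinaryGroup.Carrier Γ) ℓ'
Cay Γ Ω u v = Ω (u + (- v))
  where open BinaryGroup Γ

record Cycle {v e} {V : Set v} (G : Graph V e) (n : ℕ) : Set (v ⊔ e) where
  field
    m : ℕ
    n≡ : n ≡ suc m
    3≤n : 3 ≤ n
    c : Fin (suc m) → V
    distinct : Injective _≡_ _≡_ c
    step : (i : Fin m) → G (c (inject₁ i)) (c (suc i))
    close : G (c (fromℕ m)) (c zero)

HasOddGirth : ∀ {v e} {V : Set v} → Graph V e → ℕ → Set _
HasOddGirth G g =
  (∃ λ k → g ≡ suc (2 * k)) × Cycle G g ×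
  (∀ n → (∃ λ k → n ≡ suc (2 * k)) → Cycle G n → g ≤ n)

_⊕_ : ∀ {d} → Vec Bool d → Vec Bool d → Vec Bool d
_⊕_ = zipWith _xor_

basis : ∀ {d} → Fin d → Vec Bool d
basis i = updateAt (replicate _ false) i (λ _ → true)

J : ∀ {d} → Vec Bool d
J = replicate _ true

-- Projective cube PC_d = Cay(Z_2^d, {e_1..e_d, J}) (u - v = u ⊕ v in Z_2^d).
PC : (d : ℕ) → Graph (Vec Bool d) Level.zero
PC d u v = (∃ λ i → u ⊕ v ≡ basis i) ⊎ (u ⊕ v ≡ J)

IsSubgraphOf : ∀ {v₁ e₁ v₂ e₂} {V₁ : Set v₁} {V₂ : Set v₂} →
               Graph V₁ e₁ → Graph V₂ e₂ → Set _
IsSubgraphOf {V₁ = V₁} {V₂} H G =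
  Σ (V₁ → V₂) λ φ → Injective _≡_ _≡_ φ × (∀ u v → H u v → G (φ u) (φ v))

module Submission where

-- Let c₀ … c₂ₖ be an odd cycle of length 2k+1 and wᵢ = cᵢ ∙ cᵢ₊₁ (i < 2k),
-- w* = c₀ ∙ c₂ₖ its edge labels (in a binary group -v = v, so u ~ v iff
-- u ∙ v ∈ Ω).  They are nonzero elements of Ω and telescope: w₀ ∙ … ∙ w₂ₖ₋₁ = w*.
-- The map φ(x) = Σ_{xᵢ = 1} wᵢ on Z₂^{2k} is additive, sends eᵢ to wᵢ and J to
-- w*, so it maps edges of PC₂ₖ to edges.  It is injective since its kernel is
-- trivial: if φ(d) = 0 with d ≠ 0, the words (wᵢ)_{dᵢ=1} and w* (wᵢ)_{dᵢ=0} are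
-- relations (words summing to 0) of total length 2k+1, each shorter than 2k+1,
-- so one of them is an odd relation shorter than the odd-girth.  The key
-- lemma excludes that: an odd relation among nonzero generators spells a
-- closed walk (its prefix sums); if two prefix sums coincide, the walk splits
-- into two shorter relations, one of them odd, and otherwise it is an odd
-- cycle, whose length the odd-girth bounds.

open import Defs
open import Level using (_⊔_)
open import Data.Nat using (ℕ; zero; suc; _+_; _*_; _≤_; _<_; z≤n; s≤s)
open import Data.Nat.Properties
  using (*-suc; *-distribˡ-+; even≢odd; +-suc; 1+n≢n; m<n⇒0<n∸m; m<m+n; m<n+m; m+n≤o⇒m≤o;
         +-monoˡ-≤; ≤-trans; ≤-reflexive; <-trans; <⇒≱; +-commutativeSemigroup)
open import Data.Nat.Induction using (<-wellFounded)
open import Induction.WellFounded using (Acc; acc)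
open import Data.Fin using (Fin; zero; suc; toℕ; inject₁; fromℕ)
open import Data.Fin.Properties using (toℕ-inject₁; toℕ-fromℕ; toℕ<n; <-cmp)
open import Data.Bool using (Bool; true; false)
open import Data.Vec using (Vec; []; _∷_; tail; lookup; tabulate; replicate; toList)
open import Data.Vec.Properties using (lookup∘tabulate)
open import Data.List using (List; []; _∷_; _++_; _∷ʳ_; [_]; length; take; drop; foldr)
import Data.List as List
open import Data.List.Properties using (length-++; length-drop; take++drop≡id; take-suc; take-all; length-++-≤ʳ)
open import Data.List.Relation.Unary.All as All using (All; []; _∷_)
open import Data.List.Relation.Unary.All.Properties using (++⁺; ++⁻ˡ; ++⁻ʳ)
open import Data.List.Membership.Propositional.Properties using (∈-lookup)
open import Data.Product using (∃; ∃₂; _×_; _,_; proj₁)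
open import Data.Sum using (_⊎_; inj₁; inj₂)
open import Data.Empty using (⊥; ⊥-elim)
open import Relation.Unary using (Pred)
open import Relation.Binary.PropositionalEquality
  using (_≡_; _≢_; refl; sym; trans; cong; cong₂; subst; module ≡-Reasoning)
open import Relation.Binary.Definitions using (tri<; tri≈; tri>)
open import Function.Definitions using (Injective)
open import Algebra.Bundles using (AbelianGroup)
import Algebra.Properties.AbelianGroup as AbelianGroupProperties
import Algebra.Properties.CommutativeSemigroup as CommutativeSemigroupProperties
open CommutativeSemigroupProperties +-commutativeSemigroup using () renaming (x∙yz≈y∙xz to m+[n+o]≡n+[m+o])
open ≡-Reasoning

Odd : ℕ → Set
Odd n = ∃ λ t → n ≡ suc (2 * t)

Even : ℕ → Set
Even n = ∃ λ t → n ≡ 2 * t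

parity : ∀ n → Even n ⊎ Odd n
parity zero = inj₁ (0 , refl)
parity (suc n) with parity n
... | inj₁ (t , n≡2t)   = inj₂ (t , cong suc n≡2t)
... | inj₂ (t , n≡1+2t) = inj₁ (suc t , trans (cong suc n≡1+2t) (sym (*-suc 2 t)))

odd-+ : ∀ m n → Odd (m + n) → Odd m ⊎ Odd n
odd-+ m n (t , m+n≡1+2t) with parity m | parity n
... | inj₂ odd-m | _ = inj₁ odd-m
... | _ | inj₂ odd-n = inj₂ odd-n
... | inj₁ (s , m≡2s) | inj₁ (s′ , n≡2s′) = ⊥-elim (even≢odd (s + s′) t (begin
  2 * (s + s′)    ≡⟨ *-distribˡ-+ 2 s s′ ⟩
  2 * s + 2 * s′  ≡⟨ cong₂ _+_ m≡2s n≡2s′ ⟨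
  m + n           ≡⟨ m+n≡1+2t ⟩
  suc (2 * t)     ∎))

module _ {a} {A : Set a} where

  split-at-positions : ∀ i j (xs : List A) → i < j → j < length xs →
    ∃₂ λ P D → ∃ λ E → xs ≡ P ++ D ++ E × take i xs ≡ P × take j xs ≡ P ++ D
                       × 0 < length D × 0 < length E
  split-at-positions zero (suc j) (x ∷ xs) _ (s≤s j<len) =
    [] , take (suc j) (x ∷ xs) , drop j xs , sym (take++drop≡id (suc j) (x ∷ xs)) , refl , refl ,
    s≤s z≤n , subst (0 <_) (sym (length-drop j xs)) (m<n⇒0<n∸m j<len)
  split-at-positions (suc i) (suc j) (x ∷ xs) (s≤s i<j) (s≤s j<len)
    with split-at-positions i j xs i<j j<len
  ... | P , D , E , xs≡PDE , take-i , take-j , D⁺ , E⁺ =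
    x ∷ P , D , E , cong (x ∷_) xs≡PDE , cong (x ∷_) take-i , cong (x ∷_) take-j , D⁺ , E⁺

  length-middle : ∀ (P D E : List A) → length (P ++ D ++ E) ≡ length D + length (P ++ E)
  length-middle P D E = begin
    length (P ++ D ++ E)              ≡⟨ length-++ P ⟩
    length P + length (D ++ E)        ≡⟨ cong (length P +_) (length-++ D) ⟩
    length P + (length D + length E)  ≡⟨ m+[n+o]≡n+[m+o] (length P) (length D) (length E) ⟩
    length D + (length P + length E)  ≡⟨ cong (length D +_) (length-++ P) ⟨
    length D + length (P ++ E)        ∎

module BinaryGroupFacts {ℓ} (Γ : BinaryGroup ℓ) where
  open BinaryGroup Γ public using (Carrier; -_; binary) renaming (_+_ to _∙_; 0# to ε)
  open BinaryGroup Γ using (isAbelianGroup)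

  abelianGroup : AbelianGroup ℓ ℓ
  abelianGroup = record { isAbelianGroup = isAbelianGroup }

  open AbelianGroup abelianGroup public using (assoc; comm; identityˡ; identityʳ)
  open AbelianGroupProperties abelianGroup public using (∙-cancelˡ)
  open AbelianGroupProperties abelianGroup using (inverseˡ-unique; inverseʳ-unique)
  open CommutativeSemigroupProperties (AbelianGroup.commutativeSemigroup abelianGroup)
    using (x∙yz≈y∙xz; interchange)

  self-inverse : ∀ x → - x ≡ x
  self-inverse x = sym (inverseʳ-unique x x (binary x))

  x∙y≡ε⇒x≡y : ∀ {x y} → x ∙ y ≡ ε → x ≡ y
  x∙y≡ε⇒x≡y {x} {y} x∙y≡ε = trans (inverseˡ-unique x y x∙y≡ε) (self-inverse y)

  x∙[x∙y]≡y : ∀ x y → x ∙ (x ∙ y) ≡ y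
  x∙[x∙y]≡y x y = begin
    x ∙ (x ∙ y)  ≡⟨ assoc x x y ⟨
    (x ∙ x) ∙ y  ≡⟨ cong (_∙ y) (binary x) ⟩
    ε ∙ y        ≡⟨ identityˡ y ⟩
    y            ∎

  [w∙x]∙[w∙y]≡x∙y : ∀ w x y → (w ∙ x) ∙ (w ∙ y) ≡ x ∙ y
  [w∙x]∙[w∙y]≡x∙y w x y = begin
    (w ∙ x) ∙ (w ∙ y)  ≡⟨ interchange w x w y ⟩
    (w ∙ w) ∙ (x ∙ y)  ≡⟨ cong (_∙ (x ∙ y)) (binary w) ⟩
    ε ∙ (x ∙ y)        ≡⟨ identityˡ (x ∙ y) ⟩
    x ∙ y              ∎

  sum : List Carrier → Carrier
  sum = foldr _∙_ ε

  sum-++ : ∀ xs ys → sum (xs ++ ys) ≡ sum xs ∙ sum ys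
  sum-++ []       ys = sym (identityˡ (sum ys))
  sum-++ (x ∷ xs) ys = trans (cong (x ∙_) (sum-++ xs ys)) (sym (assoc x (sum xs) (sum ys)))

  sum-delete-trivial : ∀ P D E → sum D ≡ ε → sum (P ++ D ++ E) ≡ sum (P ++ E)
  sum-delete-trivial P D E sum-D≡ε = begin
    sum (P ++ D ++ E)            ≡⟨ sum-++ P (D ++ E) ⟩
    sum P ∙ sum (D ++ E)         ≡⟨ cong (sum P ∙_) (sum-++ D E) ⟩
    sum P ∙ (sum D ∙ sum E)      ≡⟨ cong (λ s → sum P ∙ (s ∙ sum E)) sum-D≡ε ⟩
    sum P ∙ (ε ∙ sum E)          ≡⟨ cong (sum P ∙_) (identityˡ (sum E)) ⟩
    sum P ∙ sum E                ≡⟨ sum-++ P E ⟨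
    sum (P ++ E)                 ∎

  telescope : ∀ {m} (f : Fin (suc m) → Carrier) →
              sum (toList (tabulate (λ i → f (inject₁ i) ∙ f (suc i)))) ≡ f zero ∙ f (fromℕ m)
  telescope {zero}  f = sym (binary (f zero))
  telescope {suc m} f = begin
    (f zero ∙ f (suc zero)) ∙ sum (toList (tabulate (λ i → f (suc (inject₁ i)) ∙ f (suc (suc i)))))
      ≡⟨ cong ((f zero ∙ f (suc zero)) ∙_) (telescope (λ i → f (suc i))) ⟩
    (f zero ∙ f (suc zero)) ∙ (f (suc zero) ∙ f (fromℕ (suc m)))
      ≡⟨ assoc (f zero) (f (suc zero)) _ ⟩
    f zero ∙ (f (suc zero) ∙ (f (suc zero) ∙ f (fromℕ (suc m))))
      ≡⟨ cong (f zero ∙_) (x∙[x∙y]≡y (f (suc zero)) (f (fromℕ (suc m)))) ⟩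
    f zero ∙ f (fromℕ (suc m))
      ∎

  -- The subword of ws selected by an indicator vector x ∈ Z₂ⁿ; its value
  -- x ↦ sum (select x ws) is the homomorphism Z₂ⁿ → Γ sending eᵢ to wsᵢ.
  select : ∀ {n} → Vec Bool n → Vec Carrier n → List Carrier
  select []          []       = []
  select (true  ∷ x) (w ∷ ws) = w ∷ select x ws
  select (false ∷ x) (w ∷ ws) = select x ws

  sum-select-⊕ : ∀ {n} (x y : Vec Bool n) ws →
                 sum (select (x ⊕ y) ws) ≡ sum (select x ws) ∙ sum (select y ws)
  sum-select-⊕ []          []          []       = sym (identityˡ ε)
  sum-select-⊕ (true  ∷ x) (true  ∷ y) (w ∷ ws) =
    trans (sum-select-⊕ x y ws) (sym ([w∙x]∙[w∙y]≡x∙y w _ _))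
  sum-select-⊕ (true  ∷ x) (false ∷ y) (w ∷ ws) =
    trans (cong (w ∙_) (sum-select-⊕ x y ws)) (sym (assoc w _ _))
  sum-select-⊕ (false ∷ x) (true  ∷ y) (w ∷ ws) =
    trans (cong (w ∙_) (sum-select-⊕ x y ws)) (x∙yz≈y∙xz w _ _)
  sum-select-⊕ (false ∷ x) (false ∷ y) (w ∷ ws) = sum-select-⊕ x y ws

  select-zero : ∀ {n} (ws : Vec Carrier n) → select (replicate n false) ws ≡ []
  select-zero []       = refl
  select-zero (w ∷ ws) = select-zero ws

  select-basis : ∀ {n} (i : Fin n) ws → select (basis i) ws ≡ [ lookup ws i ]
  select-basis zero    (w ∷ ws) = cong (w ∷_) (select-zero ws)
  select-basis (suc i) (w ∷ ws) = select-basis i ws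

  select-J : ∀ {n} (ws : Vec Carrier n) → select J ws ≡ toList ws
  select-J []       = refl
  select-J (w ∷ ws) = cong (w ∷_) (select-J ws)

  length-select-complement : ∀ {n} (x : Vec Bool n) ws →
                             length (select x ws) + length (select (x ⊕ J) ws) ≡ n
  length-select-complement []          []       = refl
  length-select-complement (true  ∷ x) (w ∷ ws) = cong suc (length-select-complement x ws)
  length-select-complement (false ∷ x) (w ∷ ws) =
    trans (+-suc _ _) (cong suc (length-select-complement x ws))

  select-empty : ∀ {n} (x : Vec Bool n) ws → length (select x ws) ≡ 0 → x ≡ replicate n false
  select-empty []          []       _  = refl
  select-empty (false ∷ x) (w ∷ ws) eq = cong (false ∷_) (select-empty x ws eq)

  All-select : ∀ {p} {P : Pred Carrier p} {n} (x : Vec Bool n) ws →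
               (∀ i → P (lookup ws i)) → All P (select x ws)
  All-select []          []       _  = []
  All-select (true  ∷ x) (w ∷ ws) ps = ps zero ∷ All-select x ws (λ i → ps (suc i))
  All-select (false ∷ x) (w ∷ ws) ps = All-select x ws (λ i → ps (suc i))

⊕-zero⇒≡ : ∀ {n} (u v : Vec Bool n) → u ⊕ v ≡ replicate n false → u ≡ v
⊕-zero⇒≡ []          []          _  = refl
⊕-zero⇒≡ (true  ∷ u) (true  ∷ v) eq = cong (true ∷_) (⊕-zero⇒≡ u v (cong tail eq))
⊕-zero⇒≡ (false ∷ u) (false ∷ v) eq = cong (false ∷_) (⊕-zero⇒≡ u v (cong tail eq))

module CayleyGraph {ℓ ℓ′} (Γ : BinaryGroup ℓ) (Ω : Pred (BinaryGroup.Carrier Γ) ℓ′) where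
  open BinaryGroupFacts Γ

  G : Graph Carrier ℓ′
  G = Cay Γ Ω

  -- Since -v = v, the vertices u and v are adjacent iff u ∙ v ∈ Ω.
  edge⇒label : ∀ {u v} → G u v → Ω (u ∙ v)
  edge⇒label {u} {v} = subst Ω (cong (u ∙_) (self-inverse v))

  label⇒edge : ∀ {u v} → Ω (u ∙ v) → G u v
  label⇒edge {u} {v} = subst Ω (cong (u ∙_) (sym (self-inverse v)))

  Generator : Carrier → Set (ℓ ⊔ ℓ′)
  Generator w = Ω w × w ≢ ε

  edge-generator : ∀ {u v} → G u v → u ≢ v → Generator (u ∙ v)
  edge-generator u~v u≢v = edge⇒label u~v , λ u∙v≡ε → u≢v (x∙y≡ε⇒x≡y u∙v≡ε)

  record OddRelation (xs : List Carrier) : Set (ℓ ⊔ ℓ′) where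
    constructor odd-relation
    field
      odd-length : Odd (length xs)
      generators : All Generator xs
      trivial    : sum xs ≡ ε

  NoOddRelationBelow : ℕ → Set (ℓ ⊔ ℓ′)
  NoOddRelationBelow g = ∀ xs → OddRelation xs → length xs < g → ⊥

  -- The closed walk from ε spelled by a word visits its prefix sums.
  vertex : (xs : List Carrier) → Fin (length xs) → Carrier
  vertex xs i = sum (take (toℕ i) xs)

  prefix-sum-edge : ∀ xs → All Ω xs → (i : Fin (length xs)) →
                    G (sum (take (toℕ i) xs)) (sum (take (suc (toℕ i)) xs))
  prefix-sum-edge xs Ω-xs i = label⇒edge (subst Ω (sym difference) (All.lookup Ω-xs (∈-lookup i)))
    where
      s = sum (take (toℕ i) xs)
      x = List.lookup xs i
      difference : s ∙ sum (take (suc (toℕ i)) xs) ≡ x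
      difference = begin
        s ∙ sum (take (suc (toℕ i)) xs)  ≡⟨ cong (λ ys → s ∙ sum ys) (take-suc xs i) ⟩
        s ∙ sum (take (toℕ i) xs ∷ʳ x)   ≡⟨ cong (s ∙_) (sum-++ (take (toℕ i) xs) [ x ]) ⟩
        s ∙ (s ∙ (x ∙ ε))                ≡⟨ cong (λ y → s ∙ (s ∙ y)) (identityʳ x) ⟩
        s ∙ (s ∙ x)                      ≡⟨ x∙[x∙y]≡y s x ⟩
        x                                ∎

  cycle-of-word : ∀ y ys → let xs = y ∷ ys in
                  3 ≤ length xs → All Ω xs → sum xs ≡ ε → Injective _≡_ _≡_ (vertex xs) →
                  Cycle G (length xs)
  cycle-of-word y ys 3≤len Ω-xs sum≡ε distinct = record
    { m = length ys ; n≡ = refl ; 3≤n = 3≤len ; c = vertex xs ; distinct = distinct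
    ; step = step ; close = close }
    where
      xs = y ∷ ys
      step : (i : Fin (length ys)) → G (vertex xs (inject₁ i)) (vertex xs (suc i))
      step i = subst (λ m → G (vertex xs (inject₁ i)) (sum (take (suc m) xs))) (toℕ-inject₁ i)
                     (prefix-sum-edge xs Ω-xs (inject₁ i))
      whole : sum (take (suc (toℕ (fromℕ (length ys)))) xs) ≡ ε
      whole = trans (cong sum (take-all _ xs (s≤s (≤-reflexive (sym (toℕ-fromℕ (length ys))))))) sum≡ε
      close : G (vertex xs (fromℕ (length ys))) (vertex xs zero)
      close = subst (G _) whole (prefix-sum-edge xs Ω-xs (fromℕ (length ys)))

  -- A repeated prefix sum cuts an odd relation P ++ D ++ E into the shorter
  -- relations D and P ++ E, one of which has odd length.
  shorter-odd-relation : ∀ {xs} → OddRelation xs → ∀ {i j} → i < j → j < length xs →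
                         sum (take i xs) ≡ sum (take j xs) →
                         ∃ λ ys → length ys < length xs × OddRelation ys
  shorter-odd-relation {xs} (odd-relation odd gens sum≡ε) {i} {j} i<j j<len same
    with split-at-positions i j xs i<j j<len
  ... | P , D , E , refl , take-i , take-j , D⁺ , E⁺ =
    pick (odd-+ (length D) (length (P ++ E)) (subst Odd (length-middle P D E) odd))
    where
      sum-D : sum D ≡ ε
      sum-D = ∙-cancelˡ (sum P) (sum D) ε (begin
        sum P ∙ sum D    ≡⟨ sum-++ P D ⟨
        sum (P ++ D)     ≡⟨ cong sum take-j ⟨
        sum (take j xs)  ≡⟨ same ⟨
        sum (take i xs)  ≡⟨ cong sum take-i ⟩
        sum P            ≡⟨ identityʳ (sum P) ⟨
        sum P ∙ ε        ∎)
      gens-DE : All Generator (D ++ E)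
      gens-DE = ++⁻ʳ P gens
      D<xs : length D < length xs
      D<xs = subst (length D <_) (sym (length-middle P D E))
                   (m<m+n (length D) (≤-trans E⁺ (length-++-≤ʳ E {P})))
      PE<xs : length (P ++ E) < length xs
      PE<xs = subst (length (P ++ E) <_) (sym (length-middle P D E)) (m<n+m (length (P ++ E)) D⁺)
      pick : Odd (length D) ⊎ Odd (length (P ++ E)) →
             ∃ λ ys → length ys < length xs × OddRelation ys
      pick (inj₁ odd-D)  = D , D<xs , odd-relation odd-D (++⁻ˡ D gens-DE) sum-D
      pick (inj₂ odd-PE) = P ++ E , PE<xs ,
        odd-relation odd-PE (++⁺ (++⁻ˡ P gens) (++⁻ʳ D gens-DE))
                     (trans (sym (sum-delete-trivial P D E sum-D)) sum≡ε)

  -- By well-founded induction on the length: a shortest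
  -- counterexample has distinct prefix sums, so it spells an odd cycle.
  odd-girth-bounds-relations : ∀ g → (∀ n → Odd n → Cycle G n → g ≤ n) → NoOddRelationBelow g
  odd-girth-bounds-relations g girth xs = go xs (<-wellFounded (length xs))
    where
      go : ∀ xs → Acc _<_ (length xs) → OddRelation xs → length xs < g → ⊥
      go []               _ (odd-relation (_ , ()) _ _) _
      go (x ∷ [])         _ (odd-relation _ ((_ , x≢ε) ∷ []) x∙ε≡ε) _ =
        x≢ε (trans (sym (identityʳ x)) x∙ε≡ε)
      go (_ ∷ _ ∷ [])     _ (odd-relation (t , 2≡1+2t) _ _) _ = even≢odd 1 t 2≡1+2t
      go xs@(y ∷ ys@(_ ∷ _ ∷ _)) (acc shorter) r@(odd-relation odd gens sum≡ε) xs<g =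
        <⇒≱ xs<g (girth (length xs) odd
                    (cycle-of-word y ys (s≤s (s≤s (s≤s z≤n))) (All.map proj₁ gens) sum≡ε distinct))
        where
          repeated-vertex : ∀ {i j} → i < j → j < length xs → sum (take i xs) ≡ sum (take j xs) → ⊥
          repeated-vertex i<j j<len same with shorter-odd-relation r i<j j<len same
          ... | zs , zs<xs , r′ = go zs (shorter zs<xs) r′ (<-trans zs<xs xs<g)
          distinct : Injective _≡_ _≡_ (vertex xs)
          distinct {i} {j} same with <-cmp i j
          ... | tri< i<j _ _ = ⊥-elim (repeated-vertex i<j (toℕ<n j) same)
          ... | tri≈ _ i≡j _ = i≡j
          ... | tri> _ _ j<i = ⊥-elim (repeated-vertex j<i (toℕ<n i) (sym same))

  module CycleLabels {m} (c : Fin (suc m) → Carrier) (distinct : Injective _≡_ _≡_ c)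
                     (step : ∀ i → G (c (inject₁ i)) (c (suc i)))
                     (close : G (c (fromℕ m)) (c zero)) (3≤1+m : 3 ≤ suc m) where
    labels : Vec Carrier m
    labels = tabulate (λ i → c (inject₁ i) ∙ c (suc i))

    closing-label : Carrier
    closing-label = c zero ∙ c (fromℕ m)

    labels-generate : ∀ i → Generator (lookup labels i)
    labels-generate i rewrite lookup∘tabulate (λ i → c (inject₁ i) ∙ c (suc i)) i =
      edge-generator (step i) λ same →
        1+n≢n (trans (cong toℕ (sym (distinct same))) (toℕ-inject₁ i))

    closing-generates : Generator closing-label
    closing-generates = subst Generator (comm (c (fromℕ m)) (c zero))
      (edge-generator close λ same → fromℕ≢zero 3≤1+m (distinct same))
      where
        fromℕ≢zero : ∀ {m} → 3 ≤ suc m → fromℕ m ≢ zero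
        fromℕ≢zero (s≤s (s≤s _)) ()

    labels-telescope : sum (toList labels) ≡ closing-label
    labels-telescope = telescope c

  module ProjectiveCube {n} (ws : Vec Carrier n) (w* : Carrier)
                        (ws-generate : ∀ i → Generator (lookup ws i)) (w*-generates : Generator w*)
                        (ws-sum : sum (toList ws) ≡ w*) where
    φ : Vec Bool n → Carrier
    φ x = sum (select x ws)

    φ-J : φ J ≡ w*
    φ-J = trans (cong sum (select-J ws)) ws-sum

    φ-edge : ∀ u v → PC n u v → G (φ u) (φ v)
    φ-edge u v u~v = label⇒edge (subst Ω (sum-select-⊕ u v ws) (label u~v))
      where
        label : PC n u v → Ω (φ (u ⊕ v))
        label (inj₁ (i , u⊕v≡eᵢ)) rewrite u⊕v≡eᵢ | select-basis i ws =
          subst Ω (sym (identityʳ (lookup ws i))) (proj₁ (ws-generate i))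
        label (inj₂ u⊕v≡J) rewrite u⊕v≡J = subst Ω (sym φ-J) (proj₁ w*-generates)

    -- For n even and no odd relation of length ≤ n, φ has trivial kernel: for
    -- d ≠ 0 with φ(d) = ε, the subword S selected by d and the word T = w* ∷
    -- (subword selected by d ⊕ J) are relations of total length n + 1, each of
    -- length ≤ n, and one of them is odd.
    module _ (odd : Odd (suc n)) (no-short : NoOddRelationBelow (suc n)) where
      nonzero-kernel-impossible : ∀ d → 0 < length (select d ws) → φ d ≡ ε → ⊥
      nonzero-kernel-impossible d S⁺ φd≡ε =
        pick (odd-+ (length S) (length T) (subst Odd (sym lengths) odd))
        where
          S T : List Carrier
          S = select d ws
          T = w* ∷ select (d ⊕ J) ws
          lengths : length S + length T ≡ suc n
          lengths = trans (+-suc _ _) (cong suc (length-select-complement d ws))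
          sum-T : sum T ≡ ε
          sum-T = begin
            w* ∙ φ (d ⊕ J)      ≡⟨ cong (w* ∙_) (sum-select-⊕ d J ws) ⟩
            w* ∙ (φ d ∙ φ J)    ≡⟨ cong₂ (λ s t → w* ∙ (s ∙ t)) φd≡ε φ-J ⟩
            w* ∙ (ε ∙ w*)       ≡⟨ cong (w* ∙_) (identityˡ w*) ⟩
            w* ∙ w*             ≡⟨ binary w* ⟩
            ε                   ∎
          S≤n : length S ≤ n
          S≤n = m+n≤o⇒m≤o (length S) (≤-reflexive (length-select-complement d ws))
          T≤n : length T ≤ n
          T≤n = ≤-trans (+-monoˡ-≤ (length (select (d ⊕ J) ws)) S⁺)
                        (≤-reflexive (length-select-complement d ws))
          pick : Odd (length S) ⊎ Odd (length T) → ⊥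
          pick (inj₁ odd-S) = no-short S (odd-relation odd-S (All-select d ws ws-generate) φd≡ε) (s≤s S≤n)
          pick (inj₂ odd-T) =
            no-short T (odd-relation odd-T (w*-generates ∷ All-select (d ⊕ J) ws ws-generate) sum-T) (s≤s T≤n)

      kernel-trivial : ∀ d → φ d ≡ ε → d ≡ replicate n false
      kernel-trivial d φd≡ε with length (select d ws) in len
      ... | zero  = select-empty d ws len
      ... | suc _ = ⊥-elim (nonzero-kernel-impossible d (subst (0 <_) (sym len) (s≤s z≤n)) φd≡ε)

      φ-injective : Injective _≡_ _≡_ φ
      φ-injective {u} {v} φu≡φv = ⊕-zero⇒≡ u v (kernel-trivial (u ⊕ v) (begin
        φ (u ⊕ v)  ≡⟨ sum-select-⊕ u v ws ⟩
        φ u ∙ φ v  ≡⟨ cong (_∙ φ v) φu≡φv ⟩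
        φ v ∙ φ v  ≡⟨ binary (φ v) ⟩
        ε          ∎))

theorem5 : ∀ {ℓ ℓ'} (Γ : BinaryGroup ℓ) (Ω : Pred (BinaryGroup.Carrier Γ) ℓ') (k : ℕ) →
    HasOddGirth (Cay Γ Ω) (suc (2 * k)) →
    IsSubgraphOf (PC (2 * k)) (Cay Γ Ω)
theorem5 Γ Ω k (_ , record { n≡ = refl ; 3≤n = 3≤n ; c = c ; distinct = distinct
                           ; step = step ; close = close } , girth) =
  φ , φ-injective (k , refl) (odd-girth-bounds-relations (suc (2 * k)) girth) , φ-edge
  where
    open CayleyGraph Γ Ω
    open CycleLabels c distinct step close 3≤n
    open ProjectiveCube labels closing-label labels-generate closing-generates labels-telescope
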